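{- Let $\mathcal{T}$ be any response tree (as defined in the context). For each request $r_j$ in $\mathcal{T}$, $ld(r_j) \le W(r_j)$.
   Context: Setting: metric space $\mathcal{M}$ with distance $d$; server sites $s_1,\dots,s_n$ and requests $r_1,\dots,r_n$ arriving in this order. Each site has one server for the optimal solution and $k \ge 3$ servers for the online algorithm. The optimal solution assigns $r_i$ to $s_i$ (adversary edge $(r_i,s_i)$), and $\mathrm{GREEDY}$ (which assigns each arriving request to a nearest site with an unused server) assigns $r_i$ to $s_{\sigma(i)}$ (online edge $(s_{\sigma(i)}, r_i)$). The response graph $\mathcal{G}$ has vertex set the sites and requests, and edge set all adversary and online edges, each weighted by the distance in $\mathcal{M}$ between its endpoints. The response graph is decomposed into response trees by repeatedly taking, in a remaining connected component $\mathcal{C}$, the most recent request $r_i$, deleting its online edge $(s_{\sigma(i)}, r_i)$ (the remaining component of $r_i$ is then a tree), forming the tree rooted at $r_i$ consisting of all vertices reachable from $r_i$ in this component by paths having no internal server site that was unfull (had an unused online server) at the arrival time of $r_i$, and removing its edges and request vertices from $\mathcal{G}$. Each response tree $\mathcal{T}$ rooted at a request $r_i$ is a subgraph of $\mathcal{G}$ with: every request $r_j \in \mathcal{T}$ has exactly one child, $s_j$; every leaf is a site $s_j$ with parent $r_j$; every non-leaf site in $\mathcal{T}$ has exactly $k$ children, joined to it by its $k$ online edges; for every request $r_j \in \mathcal{T}$ and every leaf $s_q$ of $\mathcal{T}$, $\mathrm{GREEDY}$ had an unused server at $s_q$ when $r_j$ arrived. For a vertex $x \in \mathcal{T}$, $ld(x)$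 is the minimum, over leaves $\ell$ of the subtree of $\mathcal{T}$ rooted at $x$, of the total edge weight of the path from $x$ to $\ell$ in $\mathcal{T}$. The weighted tree cost of a request $r_j \in \mathcal{T}$ is defined recursively: if $s_j$ is a leaf, $W(r_j) = d(r_j,s_j)$; otherwise, letting $r_{\delta(1)},\dots,r_{\delta(k)}$ be the children of $s_j$, $W(r_j) = d(r_j,s_j) + \frac{2}{k}\sum_{h=1}^k W(r_{\delta(h)})$.
   Formalization: The distances $d$ of the metric space $\mathcal{M}$ take only rational values. -}

module Defs where

open import Data.Nat as ℕ using (ℕ; NonZero)
open import Data.Fin as Fin using (Fin)
open import Data.Fin.Properties using (_≟_)
open import Data.Integer using (+_)
open import Data.Rational as ℚ using (ℚ; _+_; _*_; _⊓_; _/_; 0ℚ)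
open import Data.List as List using (List; []; _∷_; [_]; map; concat; tabulate; filter; length; allFin)
open import Data.List.Membership.Propositional using (_∈_)
open import Data.List.Relation.Unary.Unique.Propositional using (Unique)
open import Data.Product using (_×_)
open import Data.Unit using (⊤)
open import Relation.Nullary.Decidable using (_×-dec_)
open import Relation.Binary.PropositionalEquality using (_≡_)

record MetricSpace : Set₁ where
  field
    Carrier   : Set
    d         : Carrier → Carrier → ℚ
    d-nonneg  : ∀ x y → 0ℚ ℚ.≤ d x y
    d-zero    : ∀ x y → d x y ≡ 0ℚ → x ≡ y
    d-refl    : ∀ x → d x x ≡ 0ℚ
    d-sym     : ∀ x y → d x y ≡ d y x
    d-triangle : ∀ x y z → d x z ℚ.≤ d x y + d y z

open MetricSpace public

sumF : (m : ℕ) → (Fin m → ℚ) → ℚ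
sumF ℕ.zero    f = 0ℚ
sumF (ℕ.suc m) f = f Fin.zero + sumF m (λ h → f (Fin.suc h))

-- minimum of a list; only ever applied to nonempty lists (the default
-- value for [] is irrelevant)
minL : List ℚ → ℚ
minL []           = 0ℚ
minL (x ∷ [])     = x
minL (x ∷ y ∷ ys) = x ⊓ minL (y ∷ ys)

-- GREEDY.  Sites s_0..s_{n-1}, requests r_0..r_{n-1} arriving in index
-- order; σ i is the site GREEDY assigns to request i.  Each site has k
-- online servers.

usedBefore : {n : ℕ} → (Fin n → Fin n) → Fin n → Fin n → ℕ
usedBefore {n} σ i q = length (filter (λ m → (m Fin.<? i) ×-dec (σ m ≟ q)) (allFin n))

Unfull : {n : ℕ} (k : ℕ) → (Fin n → Fin n) → Fin n → Fin n → Set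
Unfull k σ i q = usedBefore σ i q ℕ.< k

IsGreedy : (M : MetricSpace) (n k : ℕ) (s r : Fin n → Carrier M) (σ : Fin n → Fin n) → Set
IsGreedy M n k s r σ =
  ∀ i → Unfull k σ i (σ i) ×
        (∀ q → Unfull k σ i q → d M (r i) (s (σ i)) ℚ.≤ d M (r i) (s q))

-- Trees rooted at a request.  'RTree n k j' is a tree rooted at request
-- r_j, whose unique child is the site s_j (adversary edge (r_j, s_j)).
-- Either s_j is a leaf, or s_j has exactly k children r_{δ h}
-- (h : Fin k), joined by online edges (s_j, r_{δ h}).

data RTree (n k : ℕ) : Fin n → Set where
  leaf : (j : Fin n) → RTree n k j
  node : (j : Fin n) (δ : Fin k → Fin n) (ch : (h : Fin k) → RTree n k (δ h)) → RTree n k j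

module _ {n k : ℕ} where

  reqs : {j : Fin n} → RTree n k j → List (Fin n)
  reqs (leaf j)       = [ j ]
  reqs (node j δ ch)  = j ∷ concat (tabulate (λ h → reqs (ch h)))

  leaves : {j : Fin n} → RTree n k j → List (Fin n)
  leaves (leaf j)      = [ j ]
  leaves (node j δ ch) = concat (tabulate (λ h → leaves (ch h)))

  OnlineEdges : (Fin n → Fin n) → {j : Fin n} → RTree n k j → Set
  OnlineEdges σ (leaf j)      = ⊤
  OnlineEdges σ (node j δ ch) = (∀ h → σ (δ h) ≡ j) × (∀ h → OnlineEdges σ (ch h))

  data _⊑_ : {i j : Fin n} → RTree n k i → RTree n k j → Set where
    here  : ∀ {j} {T : RTree n k j} → T ⊑ T
    there : ∀ {i j} {S : RTree n k i} {δ : Fin k → Fin n}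
              {ch : (h : Fin k) → RTree n k (δ h)} (h : Fin k) →
            S ⊑ ch h → S ⊑ node j δ ch

-- A response tree (with respect to the GREEDY run σ): a tree subgraph of
-- the response graph (distinct request vertices, hence distinct sites),
-- whose non-leaf sites have their k online edges as children, and such
-- that every leaf site was unfull at the arrival of every request in it.
IsResponseTree : {n k : ℕ} (σ : Fin n → Fin n) {i : Fin n} → RTree n k i → Set
IsResponseTree {n} {k} σ T =
  Unique (reqs T) × OnlineEdges σ T ×
  (∀ j q → j ∈ reqs T → q ∈ leaves T → Unfull k σ j q)

module _ (M : MetricSpace) {n k : ℕ} (s r : Fin n → Carrier M) where

  pathWeights : {j : Fin n} → RTree n k j → List ℚ
  pathWeights (leaf j)      = [ d M (r j) (s j) ]
  pathWeights (node j δ ch) =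
    map (λ x → d M (r j) (s j) + x)
        (concat (tabulate (λ h → map (λ x → d M (s j) (r (δ h)) + x) (pathWeights (ch h)))))

  ld : {j : Fin n} → RTree n k j → ℚ
  ld T = minL (pathWeights T)

  W : .{{_ : NonZero k}} → {j : Fin n} → RTree n k j → ℚ
  W (leaf j)      = d M (r j) (s j)
  W (node j δ ch) = d M (r j) (s j) + ((+ 2) / k) * sumF k (λ h → W (ch h))

-- At a non-leaf site s_j, descend to the child r_{δ h}
-- of least weighted cost; by induction its subtree has a root-to-leaf path of
-- weight w ≤ W(r_{δ h}), ending at some leaf s_ℓ.  By the triangle inequality
-- d(r_{δ h}, s_ℓ) ≤ w, and s_ℓ was unfull when r_{δ h} arrived, so GREEDY's
-- choice of s_j gives d(s_j, r_{δ h}) ≤ w.  The path through r_{δ h} thus weighs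
-- at most d(r_j, s_j) + 2 W(r_{δ h}), and a minimum is at most the average.
module Submission where

open import Defs
open import Data.Nat using (ℕ; NonZero; _≤_; zero; suc)
open import Data.Fin using (Fin; zero; suc)
open import Data.Rational using () renaming (_≤_ to _≤ℚ_)

open import Data.Integer as ℤ using (ℤ; +_)
import Data.Integer.Properties as ℤ
open import Data.Rational using (ℚ; _+_; _*_; _/_; 1ℚ; toℚᵘ)
open import Data.Rational.Properties
import Data.Rational.Unnormalised as ℚᵘ
import Data.Rational.Unnormalised.Properties as ℚᵘ
open import Data.List using (List; []; _∷_; map; tabulate)
open import Data.List.Membership.Propositional using (_∈_)
open import Data.List.Membership.Propositional.Properties
  using (∈-map⁺; ∈-map⁻; ∈-concat⁺′; ∈-concat⁻′; ∈-tabulate⁺; ∈-tabulate⁻)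
open import Data.List.Relation.Binary.Subset.Propositional using (_⊆_)
open import Data.List.Relation.Unary.Any using (here; there)
open import Data.Product using (∃; ∃₂; _×_; _,_; proj₂)
open import Data.Sum using (inj₁; inj₂)
open import Relation.Binary.PropositionalEquality using (_≡_; refl; sym; cong; cong₂; module ≡-Reasoning)

+[1+n]/1≡1+n/1 : ∀ n → + suc n / 1 ≡ 1ℚ + + n / 1
+[1+n]/1≡1+n/1 n = toℚᵘ-injective (begin
  toℚᵘ (+ suc n / 1)           ≈⟨ toℚᵘ-fromℚᵘ (ℚᵘ.mkℚᵘ (+ suc n) 0) ⟩
  ℚᵘ.mkℚᵘ (+ suc n) 0          ≈⟨ ℚᵘ.*≡* (cong (ℤ._* + 1) (sym (cong (ℤ._+_ (+ 1)) (ℤ.*-identityʳ (+ n))))) ⟩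
  ℚᵘ.1ℚᵘ ℚᵘ.+ ℚᵘ.mkℚᵘ (+ n) 0   ≈⟨ ℚᵘ.+-congʳ ℚᵘ.1ℚᵘ (ℚᵘ.≃-sym (toℚᵘ-fromℚᵘ (ℚᵘ.mkℚᵘ (+ n) 0))) ⟩
  toℚᵘ 1ℚ ℚᵘ.+ toℚᵘ (+ n / 1)   ≈⟨ ℚᵘ.≃-sym (toℚᵘ-homo-+ 1ℚ (+ n / 1)) ⟩
  toℚᵘ (1ℚ + + n / 1)          ∎)
  where open ℚᵘ.≃-Reasoning

/-*-cancel : ∀ (i : ℤ) m → (i / suc m) * (+ suc m / 1) ≡ i / 1
/-*-cancel i m = toℚᵘ-injective (begin
  toℚᵘ ((i / suc m) * (+ suc m / 1))        ≈⟨ toℚᵘ-homo-* (i / suc m) (+ suc m / 1) ⟩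
  toℚᵘ (i / suc m) ℚᵘ.* toℚᵘ (+ suc m / 1)  ≈⟨ ℚᵘ.*-cong (toℚᵘ-fromℚᵘ (ℚᵘ.mkℚᵘ i m)) (toℚᵘ-fromℚᵘ (ℚᵘ.mkℚᵘ (+ suc m) 0)) ⟩
  ℚᵘ.mkℚᵘ i m ℚᵘ.* ℚᵘ.mkℚᵘ (+ suc m) 0      ≈⟨ ℚᵘ.*≡* (ℤ.*-assoc i (+ suc m) (+ 1)) ⟩
  ℚᵘ.mkℚᵘ i 0                               ≈⟨ ℚᵘ.≃-sym (toℚᵘ-fromℚᵘ (ℚᵘ.mkℚᵘ i 0)) ⟩
  toℚᵘ (i / 1)                              ∎)
  where open ℚᵘ.≃-Reasoning

sumF-const : ∀ m x → sumF m (λ _ → x) ≡ (+ m / 1) * x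
sumF-const zero    x = sym (*-zeroˡ x)
sumF-const (suc m) x = begin
  x + sumF m (λ _ → x)    ≡⟨ cong₂ _+_ (sym (*-identityˡ x)) (sumF-const m x) ⟩
  1ℚ * x + (+ m / 1) * x  ≡⟨ sym (*-distribʳ-+ x 1ℚ (+ m / 1)) ⟩
  (1ℚ + + m / 1) * x      ≡⟨ cong (_* x) (sym (+[1+n]/1≡1+n/1 m)) ⟩
  (+ suc m / 1) * x       ∎
  where open ≡-Reasoning

sumF-mono-≤ : ∀ m {f g : Fin m → ℚ} → (∀ h → f h ≤ℚ g h) → sumF m f ≤ℚ sumF m g
sumF-mono-≤ zero    f≤g = ≤-refl
sumF-mono-≤ (suc m) f≤g = +-mono-≤ (f≤g zero) (sumF-mono-≤ m (λ h → f≤g (suc h)))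

argmin : ∀ m (f : Fin (suc m) → ℚ) → ∃ λ h → ∀ h′ → f h ≤ℚ f h′
argmin zero    f = zero , λ { zero → ≤-refl }
argmin (suc m) f with argmin m (λ h → f (suc h))
... | h , minimal with ≤-total (f zero) (f (suc h))
...   | inj₁ f₀≤ = zero  , λ { zero → ≤-refl ; (suc h′) → ≤-trans f₀≤ (minimal h′) }
...   | inj₂ ≤f₀ = suc h , λ { zero → ≤f₀   ; (suc h′) → minimal h′ }

x+x≤[2/k]*sumF : ∀ m {f : Fin (suc m) → ℚ} {x} → (∀ h → x ≤ℚ f h) →
                 x + x ≤ℚ (+ 2 / suc m) * sumF (suc m) f
x+x≤[2/k]*sumF m {f} {x} x≤f = begin
  x + x                                        ≡⟨ cong₂ _+_ (sym (*-identityˡ x)) (sym (*-identityˡ x)) ⟩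
  1ℚ * x + 1ℚ * x                              ≡⟨ sym (*-distribʳ-+ x 1ℚ 1ℚ) ⟩
  (+ 2 / 1) * x                                ≡⟨ cong (_* x) (sym (/-*-cancel (+ 2) m)) ⟩
  ((+ 2 / suc m) * (+ suc m / 1)) * x          ≡⟨ *-assoc (+ 2 / suc m) (+ suc m / 1) x ⟩
  (+ 2 / suc m) * ((+ suc m / 1) * x)          ≡⟨ cong ((+ 2 / suc m) *_) (sym (sumF-const (suc m) x)) ⟩
  (+ 2 / suc m) * sumF (suc m) (λ _ → x)       ≤⟨ *-monoˡ-≤-nonNeg (+ 2 / suc m) {{normalize-nonNeg 2 (suc m)}}
                                                    (sumF-mono-≤ (suc m) x≤f) ⟩
  (+ 2 / suc m) * sumF (suc m) f               ∎
  where open ≤-Reasoning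

minL-≤ : ∀ {x} {xs : List ℚ} → x ∈ xs → minL xs ≤ℚ x
minL-≤ {xs = x ∷ []}     (here refl) = ≤-refl
minL-≤ {xs = x ∷ y ∷ ys} (here refl) = p⊓q≤p x (minL (y ∷ ys))
minL-≤ {xs = x ∷ y ∷ ys} (there x∈) = ≤-trans (p⊓q≤q x (minL (y ∷ ys))) (minL-≤ x∈)

module _ {n k : ℕ} where

  child⊑ : ∀ {j} {δ : Fin k → Fin n} (ch : (h : Fin k) → RTree n k (δ h)) h → ch h ⊑ node j δ ch
  child⊑ ch h = there h here

  root∈reqs : ∀ {j} (T : RTree n k j) → j ∈ reqs T
  root∈reqs (leaf j)      = here refl
  root∈reqs (node j δ ch) = here refl

  ⊑⇒reqs⊆ : ∀ {i j} {S : RTree n k i} {T : RTree n k j} → S ⊑ T → reqs S ⊆ reqs T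
  ⊑⇒reqs⊆ here        q∈ = q∈
  ⊑⇒reqs⊆ (there h S⊑) q∈ = there (∈-concat⁺′ (⊑⇒reqs⊆ S⊑ q∈) (∈-tabulate⁺ h))

  ⊑⇒leaves⊆ : ∀ {i j} {S : RTree n k i} {T : RTree n k j} → S ⊑ T → leaves S ⊆ leaves T
  ⊑⇒leaves⊆ here        ℓ∈ = ℓ∈
  ⊑⇒leaves⊆ (there h S⊑) ℓ∈ = ∈-concat⁺′ (⊑⇒leaves⊆ S⊑ ℓ∈) (∈-tabulate⁺ h)

  ⊑-OnlineEdges : (σ : Fin n → Fin n) {i j : Fin n} {S : RTree n k i} {T : RTree n k j} →
                  S ⊑ T → OnlineEdges σ T → OnlineEdges σ S
  ⊑-OnlineEdges σ here         online       = online
  ⊑-OnlineEdges σ (there h S⊑) (_ , online) = ⊑-OnlineEdges σ S⊑ (online h)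

  LeavesUnfull : (σ : Fin n → Fin n) {i : Fin n} → RTree n k i → Set
  LeavesUnfull σ T = ∀ j q → j ∈ reqs T → q ∈ leaves T → Unfull k σ j q

  ⊑-LeavesUnfull : {σ : Fin n → Fin n} {i j : Fin n} {S : RTree n k i} {T : RTree n k j} →
                   S ⊑ T → LeavesUnfull σ T → LeavesUnfull σ S
  ⊑-LeavesUnfull S⊑T unfull j q j∈ q∈ = unfull j q (⊑⇒reqs⊆ S⊑T j∈) (⊑⇒leaves⊆ S⊑T q∈)

module _ (M : MetricSpace) {n k : ℕ} (s r : Fin n → Carrier M) where

  private
    pw : ∀ {j} → RTree n k j → List ℚ
    pw = pathWeights M s r

    extend : ∀ j {δ : Fin k → Fin n} h → ℚ → ℚ
    extend j {δ} h w = d M (r j) (s j) + (d M (s j) (r (δ h)) + w)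

  ∈-pathWeights-node⁺ : ∀ {j δ} (ch : (h : Fin k) → RTree n k (δ h)) h {w} →
                        w ∈ pw (ch h) → extend j {δ} h w ∈ pw (node j δ ch)
  ∈-pathWeights-node⁺ {j} {δ} ch h w∈ =
    ∈-map⁺ (λ x → d M (r j) (s j) + x)
      (∈-concat⁺′ (∈-map⁺ (λ x → d M (s j) (r (δ h)) + x) w∈)
                  (∈-tabulate⁺ {f = λ h → map (λ x → d M (s j) (r (δ h)) + x) (pw (ch h))} h))

  ∈-pathWeights-node⁻ : ∀ {j δ} (ch : (h : Fin k) → RTree n k (δ h)) {w} →
                        w ∈ pw (node j δ ch) → ∃₂ λ h w′ → w′ ∈ pw (ch h) × w ≡ extend j {δ} h w′
  ∈-pathWeights-node⁻ {j} {δ} ch w∈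
    with ∈-map⁻ (λ x → d M (r j) (s j) + x) w∈
  ... | _ , v∈ , refl
    with ∈-concat⁻′ (tabulate λ h → map (λ x → d M (s j) (r (δ h)) + x) (pw (ch h))) v∈
  ... | _ , v∈vs , vs∈
    with ∈-tabulate⁻ {f = λ h → map (λ x → d M (s j) (r (δ h)) + x) (pw (ch h))} vs∈
  ... | h , refl
    with ∈-map⁻ (λ x → d M (s j) (r (δ h)) + x) v∈vs
  ... | w′ , w′∈ , refl = h , w′ , w′∈ , refl

  pathWeight-≥-d-leaf : ∀ {j} (S : RTree n k j) {w} → w ∈ pw S →
                        ∃ λ ℓ → ℓ ∈ leaves S × d M (r j) (s ℓ) ≤ℚ w
  pathWeight-≥-d-leaf (leaf j) (here refl) = j , here refl , ≤-refl
  pathWeight-≥-d-leaf (node j δ ch) w∈ with ∈-pathWeights-node⁻ ch w∈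
  ... | h , w′ , w′∈ , refl with pathWeight-≥-d-leaf (ch h) w′∈
  ... | ℓ , ℓ∈ , d≤w′ = ℓ , ⊑⇒leaves⊆ (child⊑ {j = j} ch h) ℓ∈ , (begin
    d M (r j) (s ℓ)                                  ≤⟨ d-triangle M (r j) (s j) (s ℓ) ⟩
    a + d M (s j) (s ℓ)                              ≤⟨ +-monoʳ-≤ a (d-triangle M (s j) (r (δ h)) (s ℓ)) ⟩
    a + (d M (s j) (r (δ h)) + d M (r (δ h)) (s ℓ))  ≤⟨ +-monoʳ-≤ a (+-monoʳ-≤ (d M (s j) (r (δ h))) d≤w′) ⟩
    a + (d M (s j) (r (δ h)) + w′)                   ∎)
    where
    open ≤-Reasoning
    a : ℚ
    a = d M (r j) (s j)

  online-edge-≤ : {σ : Fin n → Fin n} → IsGreedy M n k s r σ →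
                  ∀ {i j q} → σ i ≡ j → Unfull k σ i q → d M (s j) (r i) ≤ℚ d M (r i) (s q)
  online-edge-≤ greedy {i} {q = q} refl unfull =
    ≤-trans (≤-reflexive (d-sym M (s _) (r i))) (proj₂ (greedy i) q unfull)

module _ (M : MetricSpace) {n m : ℕ} (s r : Fin n → Carrier M) (σ : Fin n → Fin n)
         (greedy : IsGreedy M n (suc m) s r σ) where

  pathWeight-≤-W : ∀ {j} (S : RTree n (suc m) j) → OnlineEdges σ S → LeavesUnfull σ S →
                   ∃ λ w → w ∈ pathWeights M s r S × w ≤ℚ W M s r S
  pathWeight-≤-W (leaf j) _ _ = _ , here refl , ≤-refl
  pathWeight-≤-W (node j δ ch) (edges-to-j , online) unfull
    with argmin m (λ h → W M s r (ch h))
  ... | h , minimal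
    with pathWeight-≤-W (ch h) (online h) (⊑-LeavesUnfull (child⊑ ch h) unfull)
  ... | w , w∈ , w≤W
    with pathWeight-≥-d-leaf M s r (ch h) w∈
  ... | ℓ , ℓ∈ , d≤w = _ , ∈-pathWeights-node⁺ M s r ch h w∈ , +-monoʳ-≤ (d M (r j) (s j)) (begin
    d M (s j) (r (δ h)) + w                              ≤⟨ +-monoˡ-≤ w (≤-trans edge≤d d≤w) ⟩
    w + w                                                ≤⟨ +-mono-≤ w≤W w≤W ⟩
    W M s r (ch h) + W M s r (ch h)                      ≤⟨ x+x≤[2/k]*sumF m minimal ⟩
    (+ 2 / suc m) * sumF (suc m) (λ h → W M s r (ch h))  ∎)
    where
    open ≤-Reasoning
    edge≤d : d M (s j) (r (δ h)) ≤ℚ d M (r (δ h)) (s ℓ)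
    edge≤d = online-edge-≤ M s r greedy (edges-to-j h)
               (⊑-LeavesUnfull (child⊑ ch h) unfull (δ h) ℓ (root∈reqs (ch h)) ℓ∈)

lemma3 : (M : MetricSpace) (n k : ℕ) .{{_ : NonZero k}} → 3 ≤ k →
         (s r : Fin n → Carrier M) (σ : Fin n → Fin n) →
         IsGreedy M n k s r σ →
         ∀ {i} (T : RTree n k i) → IsResponseTree σ T →
         ∀ {j} (S : RTree n k j) → S ⊑ T →
         ld M s r S ≤ℚ W M s r S
lemma3 M n (suc m) _ s r σ greedy T (_ , online , unfull) S S⊑T
  with pathWeight-≤-W M s r σ greedy S (⊑-OnlineEdges σ S⊑T online) (⊑-LeavesUnfull S⊑T unfull)
... | w , w∈ , w≤W = ≤-trans (minL-≤ w∈) w≤W
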